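{- Let $M=(E,\rho)$ be a binary non-degenerate $(n,k,d)$-matroid with $k\geq 3$. If $\mathcal{Z}(M)$ has height 3 and $M$ contains parallel elements, then $d=2$.
   Context: A matroid is binary if representable over $\mathbb{F}_2$; non-degenerate means it has no loops and no isthmuses. An $(n,k,d)$-matroid has $|E|=n$, $\rho(E)=k$ and minimum distance $d=\min\{|X|:X\subseteq E,\ \rho(E-X)<\rho(E)\}$. $\mathcal{Z}(M)$ is the lattice (under inclusion) of cyclic flats, i.e. sets $X$ with $\mathrm{cl}(X)=X$ and $\mathrm{cyc}(X)=X$, where $\mathrm{cl}(X)=\{e:\rho(X\cup e)=\rho(X)\}$ and $\mathrm{cyc}(X)=\{e\in X:\rho(X-e)=\rho(X)\}$. "Height 3" means the longest chains in $\mathcal{Z}(M)$ consist of three elements $0_{\mathcal{Z}}\subsetneq Z\subsetneq 1_{\mathcal{Z}}$. -}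

module Defs where

open import Data.Nat using (ℕ; zero; suc; _≤_; _<_; _+_; _≟_)
open import Data.Bool using (Bool; true; false; _xor_)
open import Data.Fin using (Fin)
import Data.Fin as F
open import Data.Fin.Subset using (Subset; ⊤; ⊥; ⁅_⁆; ∁; _∪_; _∩_; _-_; _⊆_; _⊂_; ∣_∣; _∈_)
open import Data.Vec using (Vec; []; _∷_; replicate; zipWith; tabulate)
open import Data.Product using (Σ; ∃; _×_; _,_)
open import Relation.Binary.PropositionalEquality using (_≡_; _≢_)
open import Relation.Nullary using (¬_)
open import Relation.Nullary.Decidable using (⌊_⌋)

record Matroid (n : ℕ) : Set where
  field
    ρ          : Subset n → ℕ
    ρ-bounded  : ∀ X → ρ X ≤ ∣ X ∣
    ρ-mono     : ∀ X Y → X ⊆ Y → ρ X ≤ ρ Y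
    ρ-submod   : ∀ X Y → ρ (X ∪ Y) + ρ (X ∩ Y) ≤ ρ X + ρ Y
open Matroid public

F₂^ : ℕ → Set
F₂^ m = Vec Bool m

zeroV : ∀ {m} → F₂^ m
zeroV = replicate _ false

addV : ∀ {m} → F₂^ m → F₂^ m → F₂^ m
addV = zipWith _xor_

sumOver : ∀ {n m} → (Fin n → F₂^ m) → Subset n → F₂^ m
sumOver v []          = zeroV
sumOver v (true ∷ Y)  = addV (v F.zero) (sumOver (λ i → v (F.suc i)) Y)
sumOver v (false ∷ Y) = sumOver (λ i → v (F.suc i)) Y

-- {v e : e ∈ Y} is linearly independent over F₂ (and v is injective on Y):
-- no nonempty subset of Y has vector sum zero (linear combinations over
-- F₂ are exactly subset sums).
LinIndep : ∀ {n m} → (Fin n → F₂^ m) → Subset n → Set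
LinIndep v Y = ∀ Z → Z ⊆ Y → Z ≢ ⊥ → sumOver v Z ≢ zeroV

IsF₂Rank : ∀ {n m} → (Fin n → F₂^ m) → Subset n → ℕ → Set
IsF₂Rank v X r =
  (Σ (Subset _) λ Y → Y ⊆ X × LinIndep v Y × ∣ Y ∣ ≡ r) ×
  (∀ Y → Y ⊆ X → LinIndep v Y → ∣ Y ∣ ≤ r)

Binary : ∀ {n} → Matroid n → Set
Binary {n} M = Σ ℕ λ m → Σ (Fin n → F₂^ m) λ v → ∀ X → IsF₂Rank v X (ρ M X)

IsLoop : ∀ {n} → Matroid n → Fin n → Set
IsLoop M e = ρ M ⁅ e ⁆ ≡ 0

IsIsthmus : ∀ {n} → Matroid n → Fin n → Set
IsIsthmus M e = ρ M (⊤ - e) < ρ M ⊤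

NonDegenerate : ∀ {n} → Matroid n → Set
NonDegenerate M = ∀ e → ¬ IsLoop M e × ¬ IsIsthmus M e

Parallel : ∀ {n} → Matroid n → Fin n → Fin n → Set
Parallel M e f = e ≢ f × ρ M ⁅ e ⁆ ≡ 1 × ρ M ⁅ f ⁆ ≡ 1 × ρ M (⁅ e ⁆ ∪ ⁅ f ⁆) ≡ 1

HasParallel : ∀ {n} → Matroid n → Set
HasParallel {n} M = Σ (Fin n) λ e → Σ (Fin n) λ f → Parallel M e f

IsMinDistance : ∀ {n} → Matroid n → ℕ → Set
IsMinDistance M d =
  (Σ (Subset _) λ X → ρ M (∁ X) < ρ M ⊤ × ∣ X ∣ ≡ d) ×
  (∀ X → ρ M (∁ X) < ρ M ⊤ → d ≤ ∣ X ∣)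

cl : ∀ {n} → Matroid n → Subset n → Subset n
cl M X = tabulate λ e → ⌊ ρ M (X ∪ ⁅ e ⁆) ≟ ρ M X ⌋

cyc : ∀ {n} → Matroid n → Subset n → Subset n
cyc M X = X ∩ tabulate (λ e → ⌊ ρ M (X - e) ≟ ρ M X ⌋)

IsCyclicFlat : ∀ {n} → Matroid n → Subset n → Set
IsCyclicFlat M X = cl M X ≡ X × cyc M X ≡ X

ChainOf3 : ∀ {n} → Matroid n → Set
ChainOf3 {n} M = Σ (Subset n) λ Z₀ → Σ (Subset n) λ Z₁ → Σ (Subset n) λ Z₂ →
  IsCyclicFlat M Z₀ × IsCyclicFlat M Z₁ × IsCyclicFlat M Z₂ × Z₀ ⊂ Z₁ × Z₁ ⊂ Z₂

ChainOf4 : ∀ {n} → Matroid n → Set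
ChainOf4 {n} M = Σ (Subset n) λ Z₀ → Σ (Subset n) λ Z₁ → Σ (Subset n) λ Z₂ → Σ (Subset n) λ Z₃ →
  IsCyclicFlat M Z₀ × IsCyclicFlat M Z₁ × IsCyclicFlat M Z₂ × IsCyclicFlat M Z₃ ×
  Z₀ ⊂ Z₁ × Z₁ ⊂ Z₂ × Z₂ ⊂ Z₃

Height3 : ∀ {n} → Matroid n → Set
Height3 M = ChainOf3 M × ¬ ChainOf4 M

module Submission where

-- Call the elements not parallel to e outsiders.  Height 3 leaves no room for a cyclic
-- flat strictly between cl{e,f} and E, so a set Z of fewer than ρ(E) outsiders stays
-- independent when e is added: otherwise, for Z minimal, Z ∪ {e,f} is a cyclic set of rank
-- |Z| ≥ 2 below ρ(E), and cl ∅ ⊂ cl{e,f} ⊂ cl(Z ∪ {e,f}) ⊂ E is a chain of four cyclic flats.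
-- Over F₂ this says that a nonempty set of fewer than ρ(E) outsiders has vector sum outside
-- {0, v e}, while a set of exactly ρ(E) outsiders has its sum in {0, v e}.  Hence for
-- distinct outsiders a, b there are fewer than ρ(E) − 1 further outsiders: completing
-- ρ(E) − 1 of them by a and by b would put v a + v b in {0, v e}.  As E − {a,b} is spanned
-- by e and these further outsiders, its rank drops, so d ≤ 2; and d ≥ 2 since M has no
-- isthmus.

open import Defs
open import Data.Nat using (ℕ; zero; suc; _+_; _≤_; _<_; _≟_; _≤?_; _<?_; z≤n; s≤s)
open import Data.Nat.Properties
open import Data.Bool using (true; false)
import Data.Bool.Properties as Bool
open import Data.Fin using (Fin)
import Data.Fin as F
import Data.Fin.Properties as FP
open import Data.Fin.Subset
open import Data.Fin.Subset.Properties
open import Data.Vec using ([]; _∷_; tabulate; here; there)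
import Data.Vec.Properties as VP
open import Data.Product using (Σ; _×_; _,_; proj₁; proj₂)
open import Data.Sum using (_⊎_; inj₁; inj₂; [_,_]′)
open import Data.Empty using (⊥-elim)
open import Function using (_∘_)
open import Relation.Binary.PropositionalEquality
open import Relation.Nullary
open import Relation.Nullary.Decidable using (⌊_⌋; isYes≗does; dec-true; decidable-stable)

private
  variable
    n m : ℕ
    p q r : Subset n
    x y : Fin n

∪-least : p ⊆ r → q ⊆ r → p ∪ q ⊆ r
∪-least {p = p} {q = q} p⊆r q⊆r x∈p∪q with x∈p∪q⁻ p q x∈p∪q
... | inj₁ x∈p = p⊆r x∈p
... | inj₂ x∈q = q⊆r x∈q

x∈p⇒⁅x⁆⊆p : x ∈ p → ⁅ x ⁆ ⊆ p
x∈p⇒⁅x⁆⊆p {p = p} x∈p y∈⁅x⁆ = subst (_∈ p) (sym (x∈⁅y⁆⇒x≡y _ y∈⁅x⁆)) x∈p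

x∈p─q⇒x∉q : ∀ (p q : Subset n) → x ∈ p ─ q → x ∉ q
x∈p─q⇒x∉q (true ∷ p) (false ∷ q) here          ()
x∈p─q⇒x∉q (_ ∷ p)    (_ ∷ q)     (there x∈p─q) (there x∈q) = x∈p─q⇒x∉q p q x∈p─q x∈q

x∈p-y⇒x≢y : ∀ (p : Subset n) → x ∈ p - y → x ≢ y
x∈p-y⇒x≢y {y = y} p x∈p-y refl = x∈p─q⇒x∉q p ⁅ y ⁆ x∈p-y (x∈⁅x⁆ y)

p⊆p-x∪⁅x⁆ : ∀ (p : Subset n) x → p ⊆ (p - x) ∪ ⁅ x ⁆
p⊆p-x∪⁅x⁆ p x {y} y∈p with y FP.≟ x
... | yes refl = q⊆p∪q (p - x) ⁅ x ⁆ (x∈⁅x⁆ x)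
... | no y≢x   = p⊆p∪q ⁅ x ⁆ (x∈p∧x≢y⇒x∈p-y y∈p y≢x)

p-x∪⁅x⁆≡p : x ∈ p → (p - x) ∪ ⁅ x ⁆ ≡ p
p-x∪⁅x⁆≡p {x = x} {p = p} x∈p =
  ⊆-antisym (∪-least (p─q⊆p p ⁅ x ⁆) (x∈p⇒⁅x⁆⊆p x∈p)) (p⊆p-x∪⁅x⁆ p x)

x∉p⇒p-x≡p : x ∉ p → p - x ≡ p
x∉p⇒p-x≡p {x = x} {p = p} x∉p =
  ⊆-antisym (p─q⊆p p ⁅ x ⁆) λ y∈p → x∈p∧x≢y⇒x∈p-y y∈p λ { refl → x∉p y∈p }

p⊆q∪⁅x⁆⇒p-x⊆q : p ⊆ q ∪ ⁅ x ⁆ → p - x ⊆ q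
p⊆q∪⁅x⁆⇒p-x⊆q {p = p} {q = q} {x = x} p⊆q∪x y∈p-x with x∈p∪q⁻ q ⁅ x ⁆ (p⊆q∪x (p─q⊆p p ⁅ x ⁆ y∈p-x))
... | inj₁ y∈q   = y∈q
... | inj₂ y∈⁅x⁆ = ⊥-elim (x∈p-y⇒x≢y p y∈p-x (x∈⁅y⁆⇒x≡y x y∈⁅x⁆))

p⊆q∧q⊈p⇒p⊂q : p ⊆ q → ¬ q ⊆ p → p ⊂ q
p⊆q∧q⊈p⇒p⊂q {p = p} {q = q} p⊆q q⊈p with nonempty? (q ─ p)
... | yes (x , x∈q─p) = p⊆q , x , p─q⊆p q p x∈q─p , x∈p─q⇒x∉q q p x∈q─p
... | no q─p-empty    = ⊥-elim (q⊈p q⊆p)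
  where
  q⊆p : q ⊆ p
  q⊆p {x} x∈q with x ∈? p
  ... | yes x∈p = x∈p
  ... | no x∉p  = ⊥-elim (q─p-empty (x , x∈p∧x∉q⇒x∈p─q x∈q x∉p))

Subset-induction : (P : Subset n → Set) → P ⊥ → (∀ p x → P p → P (p ∪ ⁅ x ⁆)) → ∀ p → P p
Subset-induction P P⊥ step []          = P⊥
Subset-induction P P⊥ step (false ∷ p) =
  Subset-induction (P ∘ (false ∷_)) P⊥ (λ q x → step (false ∷ q) (F.suc x)) p
Subset-induction P P⊥ step (true ∷ p)  =
  subst (P ∘ (true ∷_)) (∪-identityʳ p)
    (step (false ∷ p) F.zero (Subset-induction (P ∘ (false ∷_)) P⊥ (λ q x → step (false ∷ q) (F.suc x)) p))

∈-tabulate⁺ : {P : Fin n → Set} (P? : ∀ x → Dec (P x)) → P x → x ∈ tabulate (λ y → ⌊ P? y ⌋)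
∈-tabulate⁺ {x = x} P? Px =
  VP.lookup⇒[]= x _ (trans (VP.lookup∘tabulate _ x) (trans (isYes≗does (P? x)) (dec-true (P? x) Px)))

∈-tabulate⁻ : {P : Fin n → Set} (P? : ∀ x → Dec (P x)) → x ∈ tabulate (λ y → ⌊ P? y ⌋) → P x
∈-tabulate⁻ {x = x} P? x∈ with P? x | trans (sym (VP.lookup∘tabulate (λ y → ⌊ P? y ⌋) x)) (VP.[]=⇒lookup x∈)
... | yes Px | _ = Px
... | no _   | ()

∣p∪⁅x⁆∣≡1+∣p∣ : ∀ (p : Subset n) → x ∉ p → ∣ p ∪ ⁅ x ⁆ ∣ ≡ suc ∣ p ∣
∣p∪⁅x⁆∣≡1+∣p∣ {x = F.zero}  (true ∷ p)  x∉p = ⊥-elim (x∉p here)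
∣p∪⁅x⁆∣≡1+∣p∣ {x = F.zero}  (false ∷ p) x∉p = cong (suc ∘ ∣_∣) (∪-identityʳ p)
∣p∪⁅x⁆∣≡1+∣p∣ {x = F.suc x} (true ∷ p)  x∉p = cong suc (∣p∪⁅x⁆∣≡1+∣p∣ p (x∉p ∘ there))
∣p∪⁅x⁆∣≡1+∣p∣ {x = F.suc x} (false ∷ p) x∉p = ∣p∪⁅x⁆∣≡1+∣p∣ p (x∉p ∘ there)

∣p∣≡1+∣p-x∣ : x ∈ p → ∣ p ∣ ≡ suc ∣ p - x ∣
∣p∣≡1+∣p-x∣ {p = p} x∈p =
  trans (cong ∣_∣ (sym (p-x∪⁅x⁆≡p x∈p))) (∣p∪⁅x⁆∣≡1+∣p∣ (p - _) λ x∈p-x → x∈p-y⇒x≢y p x∈p-x refl)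

∣p∪⁅x⁆∣≤1+∣p∣ : ∀ (p : Subset n) x → ∣ p ∪ ⁅ x ⁆ ∣ ≤ suc ∣ p ∣
∣p∪⁅x⁆∣≤1+∣p∣ p x with x ∈? p
... | yes x∈p = m≤n⇒m≤1+n (p⊆q⇒∣p∣≤∣q∣ (∪-least ⊆-refl (x∈p⇒⁅x⁆⊆p x∈p)))
... | no x∉p  = ≤-reflexive (∣p∪⁅x⁆∣≡1+∣p∣ p x∉p)

∣⁅x⁆∪⁅y⁆∣≡2 : x ≢ y → ∣ ⁅ x ⁆ ∪ ⁅ y ⁆ ∣ ≡ 2
∣⁅x⁆∪⁅y⁆∣≡2 {x = x} x≢y = trans (∣p∪⁅x⁆∣≡1+∣p∣ ⁅ x ⁆ (x≢y ∘ sym ∘ x∈⁅y⁆⇒x≡y x)) (cong suc (∣⁅x⁆∣≡1 x))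

p⊆q∧∣q∣≤∣p∣⇒p≡q : p ⊆ q → ∣ q ∣ ≤ ∣ p ∣ → p ≡ q
p⊆q∧∣q∣≤∣p∣⇒p≡q {p = p} {q = q} p⊆q ∣q∣≤∣p∣ = ⊆-antisym p⊆q q⊆p
  where
  q⊆p : q ⊆ p
  q⊆p {x} x∈q with x ∈? p
  ... | yes x∈p = x∈p
  ... | no x∉p  = ⊥-elim (<⇒≱ (p⊂q⇒∣p∣<∣q∣ (p⊆q , x , x∈q , x∉p)) ∣q∣≤∣p∣)

subset-of-size : ∀ (p : Subset n) k → k ≤ ∣ p ∣ → Σ (Subset n) λ q → q ⊆ p × ∣ q ∣ ≡ k
subset-of-size {n} p       zero    _       = ⊥ , ⊥⊆ , ∣⊥∣≡0 n
subset-of-size (true ∷ p)  (suc k) k<1+∣p∣ with subset-of-size p k (≤-pred k<1+∣p∣)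
... | q , q⊆p , ∣q∣≡k = true ∷ q , s⊆s q⊆p , cong suc ∣q∣≡k
subset-of-size (false ∷ p) (suc k) k<∣p∣   with subset-of-size p (suc k) k<∣p∣
... | q , q⊆p , ∣q∣≡1+k = false ∷ q , out⊆ q⊆p , ∣q∣≡1+k

∣p∣≡0⇒p≡⊥ : ∣ p ∣ ≡ 0 → p ≡ ⊥
∣p∣≡0⇒p≡⊥ {p = []}        _     = refl
∣p∣≡0⇒p≡⊥ {p = false ∷ p} ∣p∣≡0 = cong (false ∷_) (∣p∣≡0⇒p≡⊥ ∣p∣≡0)

0<∣p∣⇒Nonempty : 0 < ∣ p ∣ → Nonempty p
0<∣p∣⇒Nonempty {p = []}        ()
0<∣p∣⇒Nonempty {p = true ∷ p}  _     = F.zero , here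
0<∣p∣⇒Nonempty {p = false ∷ p} 0<∣p∣ with 0<∣p∣⇒Nonempty 0<∣p∣
... | x , x∈p = F.suc x , there x∈p

two-elements : ∀ {p : Subset n} → 2 ≤ ∣ p ∣ → Σ (Fin n) λ x → Σ (Fin n) λ y → x ∈ p × y ∈ p × x ≢ y
two-elements {p = p} 2≤∣p∣ with 0<∣p∣⇒Nonempty (≤-trans (s≤s z≤n) 2≤∣p∣)
... | x , x∈p with 0<∣p∣⇒Nonempty (≤-pred (≤-trans 2≤∣p∣ (≤-reflexive (∣p∣≡1+∣p-x∣ x∈p))))
... | y , y∈p-x = x , y , x∈p , p─q⊆p p ⁅ x ⁆ y∈p-x , λ x≡y → x∈p-y⇒x≢y p y∈p-x (sym x≡y)

∣p∣≤1⇒p⊆⁅x⁆ : ∣ p ∣ ≤ 1 → x ∈ p → p ⊆ ⁅ x ⁆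
∣p∣≤1⇒p⊆⁅x⁆ {p = p} {x = x} ∣p∣≤1 x∈p {y} y∈p with y FP.≟ x
... | yes refl = x∈⁅x⁆ x
... | no y≢x   = ⊥-elim (<-irrefl refl (≤-trans 2≤∣p∣ ∣p∣≤1))
  where
  2≤∣p∣ : 2 ≤ ∣ p ∣
  2≤∣p∣ = ≤-trans (≤-reflexive (sym (∣⁅x⁆∪⁅y⁆∣≡2 (y≢x ∘ sym))))
                  (p⊆q⇒∣p∣≤∣q∣ (∪-least (x∈p⇒⁅x⁆⊆p x∈p) (x∈p⇒⁅x⁆⊆p y∈p)))

addV-assoc : ∀ (a b c : F₂^ m) → addV (addV a b) c ≡ addV a (addV b c)
addV-assoc = VP.zipWith-assoc Bool.xor-assoc

addV-comm : ∀ (a b : F₂^ m) → addV a b ≡ addV b a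
addV-comm = VP.zipWith-comm Bool.xor-comm

addV-identityˡ : ∀ (a : F₂^ m) → addV zeroV a ≡ a
addV-identityˡ = VP.zipWith-identityˡ Bool.xor-identityˡ

addV-identityʳ : ∀ (a : F₂^ m) → addV a zeroV ≡ a
addV-identityʳ = VP.zipWith-identityʳ Bool.xor-identityʳ

addV-self : ∀ (a : F₂^ m) → addV a a ≡ zeroV
addV-self a = trans (cong (λ b → addV b a) (sym (VP.map-id a))) (VP.zipWith-inverseˡ Bool.xor-same a)

addV≡zero⇒≡ : ∀ {a b : F₂^ m} → addV a b ≡ zeroV → a ≡ b
addV≡zero⇒≡ {a = a} {b} a+b≡0 = begin
  a                 ≡⟨ sym (addV-identityʳ a) ⟩
  addV a zeroV      ≡⟨ cong (addV a) (sym (addV-self b)) ⟩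
  addV a (addV b b) ≡⟨ sym (addV-assoc a b b) ⟩
  addV (addV a b) b ≡⟨ cong (λ c → addV c b) a+b≡0 ⟩
  addV zeroV b      ≡⟨ addV-identityˡ b ⟩
  b                 ∎
  where open ≡-Reasoning

addV-cancel-common : ∀ (c a b : F₂^ m) → addV (addV c a) (addV c b) ≡ addV a b
addV-cancel-common c a b = begin
  addV (addV c a) (addV c b) ≡⟨ cong (λ d → addV d (addV c b)) (addV-comm c a) ⟩
  addV (addV a c) (addV c b) ≡⟨ addV-assoc a c (addV c b) ⟩
  addV a (addV c (addV c b)) ≡⟨ cong (addV a) (sym (addV-assoc c c b)) ⟩
  addV a (addV (addV c c) b) ≡⟨ cong (λ d → addV a (addV d b)) (addV-self c) ⟩
  addV a (addV zeroV b)      ≡⟨ cong (addV a) (addV-identityˡ b) ⟩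
  addV a b                   ∎
  where open ≡-Reasoning

_∈⟨_⟩ : F₂^ m → F₂^ m → Set
a ∈⟨ u ⟩ = a ≡ zeroV ⊎ a ≡ u

addV-∈⟨⟩ : ∀ {u a b : F₂^ m} → a ∈⟨ u ⟩ → b ∈⟨ u ⟩ → addV a b ∈⟨ u ⟩
addV-∈⟨⟩ {u = u} (inj₁ refl) (inj₁ refl) = inj₁ (addV-self zeroV)
addV-∈⟨⟩ {u = u} (inj₁ refl) (inj₂ refl) = inj₂ (addV-identityˡ u)
addV-∈⟨⟩ {u = u} (inj₂ refl) (inj₁ refl) = inj₂ (addV-identityʳ u)
addV-∈⟨⟩ {u = u} (inj₂ refl) (inj₂ refl) = inj₁ (addV-self u)

sumOver-⊥ : ∀ (v : Fin n → F₂^ m) → sumOver v ⊥ ≡ zeroV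
sumOver-⊥ {zero}  v = refl
sumOver-⊥ {suc n} v = sumOver-⊥ (v ∘ F.suc)

sumOver-∪⁅x⁆ : ∀ (v : Fin n → F₂^ m) (p : Subset n) → x ∉ p → sumOver v (p ∪ ⁅ x ⁆) ≡ addV (sumOver v p) (v x)
sumOver-∪⁅x⁆ {x = F.zero}  v (true ∷ p)  x∉p = ⊥-elim (x∉p here)
sumOver-∪⁅x⁆ {x = F.zero}  v (false ∷ p) x∉p =
  trans (cong (addV (v F.zero) ∘ sumOver (v ∘ F.suc)) (∪-identityʳ p)) (addV-comm _ _)
sumOver-∪⁅x⁆ {x = F.suc x} v (true ∷ p)  x∉p =
  trans (cong (addV (v F.zero)) (sumOver-∪⁅x⁆ (v ∘ F.suc) p (x∉p ∘ there))) (sym (addV-assoc _ _ _))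
sumOver-∪⁅x⁆ {x = F.suc x} v (false ∷ p) x∉p = sumOver-∪⁅x⁆ (v ∘ F.suc) p (x∉p ∘ there)

sumOver-⁅x⁆∪⁅y⁆ : ∀ (v : Fin n → F₂^ m) → x ≢ y → sumOver v (⁅ x ⁆ ∪ ⁅ y ⁆) ≡ addV (v x) (v y)
sumOver-⁅x⁆∪⁅y⁆ {x = x} {y = y} v x≢y = begin
  sumOver v (⁅ x ⁆ ∪ ⁅ y ⁆)     ≡⟨ sumOver-∪⁅x⁆ v ⁅ x ⁆ (x≢y ∘ sym ∘ x∈⁅y⁆⇒x≡y x) ⟩
  addV (sumOver v ⁅ x ⁆) (v y)  ≡⟨ cong (λ a → addV a (v y)) sum⁅x⁆ ⟩
  addV (v x) (v y)              ∎
  where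
  open ≡-Reasoning
  sum⁅x⁆ : sumOver v ⁅ x ⁆ ≡ v x
  sum⁅x⁆ = begin
    sumOver v ⁅ x ⁆           ≡⟨ cong (sumOver v) (sym (∪-identityˡ ⁅ x ⁆)) ⟩
    sumOver v (⊥ ∪ ⁅ x ⁆)     ≡⟨ sumOver-∪⁅x⁆ v ⊥ ∉⊥ ⟩
    addV (sumOver v ⊥) (v x)  ≡⟨ cong (λ a → addV a (v x)) (sumOver-⊥ v) ⟩
    addV zeroV (v x)          ≡⟨ addV-identityˡ (v x) ⟩
    v x                       ∎

sumOver-minus-∈⟨⟩ : ∀ (v : Fin n → F₂^ m) p x → sumOver v p ≡ zeroV → sumOver v (p - x) ∈⟨ v x ⟩
sumOver-minus-∈⟨⟩ v p x Σp≡0 with x ∈? p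
... | yes x∈p = inj₂ (addV≡zero⇒≡ (begin
  addV (sumOver v (p - x)) (v x) ≡⟨ sym (sumOver-∪⁅x⁆ v (p - x) λ x∈p-x → x∈p-y⇒x≢y p x∈p-x refl) ⟩
  sumOver v ((p - x) ∪ ⁅ x ⁆)    ≡⟨ cong (sumOver v) (p-x∪⁅x⁆≡p x∈p) ⟩
  sumOver v p                    ≡⟨ Σp≡0 ⟩
  zeroV                          ∎))
  where open ≡-Reasoning
... | no x∉p  = inj₁ (trans (cong (sumOver v) (x∉p⇒p-x≡p x∉p)) Σp≡0)

module F₂Representation {n m : ℕ} (M : Matroid n) {v : Fin n → F₂^ m}
                        (rep : ∀ X → IsF₂Rank v X (ρ M X)) where

  independent⇒LinIndep : ∀ {X} → ρ M X ≡ ∣ X ∣ → LinIndep v X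
  independent⇒LinIndep {X} ρX≡∣X∣ with proj₁ (rep X)
  ... | Y , Y⊆X , Y-indep , ∣Y∣≡ρX =
    subst (LinIndep v) (p⊆q∧∣q∣≤∣p∣⇒p≡q Y⊆X (≤-reflexive (sym (trans ∣Y∣≡ρX ρX≡∣X∣)))) Y-indep

  DependencyIn : Subset n → Subset n → Set
  DependencyIn X W = W ⊆ X × W ≢ ⊥ × sumOver v W ≡ zeroV

  dependencyIn? : ∀ X W → Dec (DependencyIn X W)
  dependencyIn? X W = (W ⊆? X) ×-dec ¬? (VP.≡-dec Bool._≟_ W ⊥) ×-dec VP.≡-dec Bool._≟_ (sumOver v W) zeroV

  dependency : ∀ X → ρ M X < ∣ X ∣ → Σ (Subset n) (DependencyIn X)
  dependency X ρX<∣X∣ with anySubset? (dependencyIn? X)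
  ... | yes W-dep = W-dep
  ... | no ¬dep   = ⊥-elim (<⇒≱ ρX<∣X∣ (proj₂ (rep X) X ⊆-refl X-indep))
    where
    X-indep : LinIndep v X
    X-indep W W⊆X W≢⊥ ΣW≡0 = ¬dep (W , W⊆X , W≢⊥ , ΣW≡0)

module Rank {n : ℕ} (M : Matroid n) where

  ρ-monotone : ∀ {X Y} → X ⊆ Y → ρ M X ≤ ρ M Y
  ρ-monotone {X} {Y} = ρ-mono M X Y

  ρ⊥≡0 : ρ M ⊥ ≡ 0
  ρ⊥≡0 = n≤0⇒n≡0 (≤-trans (ρ-bounded M ⊥) (≤-reflexive (∣⊥∣≡0 n)))

  Spans : Subset n → Fin n → Set
  Spans A x = ρ M (A ∪ ⁅ x ⁆) ≡ ρ M A

  spans-∈ : ∀ {A x} → x ∈ A → Spans A x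
  spans-∈ {A} {x} x∈A = cong (ρ M) (⊆-antisym (∪-least ⊆-refl (x∈p⇒⁅x⁆⊆p x∈A)) (p⊆p∪q ⁅ x ⁆))

  spans-mono : ∀ {A B x} → A ⊆ B → Spans A x → Spans B x
  spans-mono {A} {B} {x} A⊆B A-spans =
    ≤-antisym (+-cancelʳ-≤ (ρ M A) _ _ bound) (ρ-monotone (p⊆p∪q ⁅ x ⁆))
    where
    open ≤-Reasoning
    bound : ρ M (B ∪ ⁅ x ⁆) + ρ M A ≤ ρ M B + ρ M A
    bound = begin
      ρ M (B ∪ ⁅ x ⁆) + ρ M A
        ≤⟨ +-mono-≤ (ρ-monotone (∪-least (p⊆p∪q _) (q⊆p∪q B _ ∘ q⊆p∪q A ⁅ x ⁆)))
                    (ρ-monotone (λ y∈A → x∈p∩q⁺ (A⊆B y∈A , p⊆p∪q ⁅ x ⁆ y∈A))) ⟩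
      ρ M (B ∪ (A ∪ ⁅ x ⁆)) + ρ M (B ∩ (A ∪ ⁅ x ⁆))
        ≤⟨ ρ-submod M B (A ∪ ⁅ x ⁆) ⟩
      ρ M B + ρ M (A ∪ ⁅ x ⁆)
        ≡⟨ cong (ρ M B +_) A-spans ⟩
      ρ M B + ρ M A
        ∎

  ρ-∪-spanned : ∀ A B → (∀ {x} → x ∈ B → Spans A x) → ρ M (A ∪ B) ≡ ρ M A
  ρ-∪-spanned A B spanned = Subset-induction P P⊥ step B ⊆-refl
    where
    P : Subset n → Set
    P C = C ⊆ B → ρ M (A ∪ C) ≡ ρ M A
    P⊥ : P ⊥
    P⊥ _ = cong (ρ M) (∪-identityʳ A)
    step : ∀ C x → P C → P (C ∪ ⁅ x ⁆)
    step C x ρA∪C≡ρA C∪x⊆B = begin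
      ρ M (A ∪ (C ∪ ⁅ x ⁆)) ≡⟨ cong (ρ M) (sym (∪-assoc A C ⁅ x ⁆)) ⟩
      ρ M ((A ∪ C) ∪ ⁅ x ⁆) ≡⟨ spans-mono (p⊆p∪q C) (spanned (C∪x⊆B (q⊆p∪q C ⁅ x ⁆ (x∈⁅x⁆ x)))) ⟩
      ρ M (A ∪ C)           ≡⟨ ρA∪C≡ρA (C∪x⊆B ∘ p⊆p∪q ⁅ x ⁆) ⟩
      ρ M A                 ∎
      where open ≡-Reasoning

  ρ-≤-spanned : ∀ {A B} → (∀ {x} → x ∈ B → Spans A x) → ρ M B ≤ ρ M A
  ρ-≤-spanned {A} {B} spanned = ≤-trans (ρ-monotone (q⊆p∪q A B)) (≤-reflexive (ρ-∪-spanned A B spanned))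

  ∈cl⇒Spans : ∀ {A x} → x ∈ cl M A → Spans A x
  ∈cl⇒Spans {A} = ∈-tabulate⁻ (λ y → ρ M (A ∪ ⁅ y ⁆) ≟ ρ M A)

  Spans⇒∈cl : ∀ {A x} → Spans A x → x ∈ cl M A
  Spans⇒∈cl {A} = ∈-tabulate⁺ (λ y → ρ M (A ∪ ⁅ y ⁆) ≟ ρ M A)

  ⊆cl : ∀ {A} → A ⊆ cl M A
  ⊆cl = Spans⇒∈cl ∘ spans-∈

  ρ-cl : ∀ A → ρ M (cl M A) ≡ ρ M A
  ρ-cl A = ≤-antisym (ρ-≤-spanned ∈cl⇒Spans) (ρ-monotone ⊆cl)

  cl-mono : ∀ {A B} → A ⊆ B → cl M A ⊆ cl M B
  cl-mono A⊆B = Spans⇒∈cl ∘ spans-mono A⊆B ∘ ∈cl⇒Spans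

  cl-idem : ∀ A → cl M (cl M A) ≡ cl M A
  cl-idem A = ⊆-antisym (Spans⇒∈cl ∘ spans-from-cl ∘ ∈cl⇒Spans) ⊆cl
    where
    spans-from-cl : ∀ {x} → Spans (cl M A) x → Spans A x
    spans-from-cl {x} clA-spans = ≤-antisym
      (≤-trans (ρ-monotone (∪-least (p⊆p∪q ⁅ x ⁆ ∘ ⊆cl) (q⊆p∪q _ ⁅ x ⁆)))
               (≤-reflexive (trans clA-spans (ρ-cl A))))
      (ρ-monotone (p⊆p∪q ⁅ x ⁆))

  Cyclic : Subset n → Set
  Cyclic Y = ∀ {y} → y ∈ Y → ρ M (Y - y) ≡ ρ M Y

  ρ-minus-≡ : ∀ {Y W x} → W ⊆ Y - x → ρ M Y ≤ ρ M W → ρ M (Y - x) ≡ ρ M Y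
  ρ-minus-≡ {Y} {x = x} W⊆Y-x ρY≤ρW = ≤-antisym (ρ-monotone (p─q⊆p Y ⁅ x ⁆)) (≤-trans ρY≤ρW (ρ-monotone W⊆Y-x))

  ρ-minus-spanned : ∀ {Y x} → Spans (Y - x) x → ρ M (Y - x) ≡ ρ M Y
  ρ-minus-spanned {Y} {x} Y-x-spans = ρ-minus-≡ ⊆-refl (≤-trans (ρ-monotone (p⊆p-x∪⁅x⁆ Y x)) (≤-reflexive Y-x-spans))

  ρ-minus-spanned-by : ∀ {Y w x} → w ∈ Y → w ≢ x → Spans ⁅ w ⁆ x → ρ M (Y - x) ≡ ρ M Y
  ρ-minus-spanned-by w∈Y w≢x w-spans = ρ-minus-spanned (spans-mono (x∈p⇒⁅x⁆⊆p (x∈p∧x≢y⇒x∈p-y w∈Y w≢x)) w-spans)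

  Cyclic⇒ρ-minus : ∀ {Y} → Cyclic Y → ∀ x → ρ M (Y - x) ≡ ρ M Y
  Cyclic⇒ρ-minus {Y} cyclic x with x ∈? Y
  ... | yes x∈Y = cyclic x∈Y
  ... | no x∉Y  = cong (ρ M) (x∉p⇒p-x≡p x∉Y)

  cyc-cl : ∀ {Y} → Cyclic Y → cyc M (cl M Y) ≡ cl M Y
  cyc-cl {Y} cyclic = ⊆-antisym (p∩q⊆p _ _) λ {x} x∈clY →
    x∈p∩q⁺ (x∈clY , ∈-tabulate⁺ (λ y → ρ M (cl M Y - y) ≟ ρ M (cl M Y)) (ρ-clY-minus x))
    where
    ρ-clY-minus : ∀ x → ρ M (cl M Y - x) ≡ ρ M (cl M Y)
    ρ-clY-minus x = ρ-minus-≡ (λ y∈Y-x → x∈p∧x≢y⇒x∈p-y (⊆cl (p─q⊆p Y ⁅ x ⁆ y∈Y-x)) (x∈p-y⇒x≢y Y y∈Y-x))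
                              (≤-reflexive (trans (ρ-cl Y) (sym (Cyclic⇒ρ-minus cyclic x))))

  cl-cyclicFlat : ∀ {Y} → Cyclic Y → IsCyclicFlat M (cl M Y)
  cl-cyclicFlat {Y} cyclic = cl-idem Y , cyc-cl cyclic

  cl-⊂ : ∀ {A B} → A ⊆ B → ρ M A < ρ M B → cl M A ⊂ cl M B
  cl-⊂ {A} {B} A⊆B ρA<ρB = p⊆q∧q⊈p⇒p⊂q (cl-mono A⊆B) λ clB⊆clA →
    <⇒≱ ρA<ρB (subst₂ _≤_ (ρ-cl B) (ρ-cl A) (ρ-monotone clB⊆clA))

  chain-of-cyclic : ∀ {A B C D} → Cyclic A → Cyclic B → Cyclic C → Cyclic D →
                    A ⊆ B → B ⊆ C → C ⊆ D → ρ M A < ρ M B → ρ M B < ρ M C → ρ M C < ρ M D →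
                    ChainOf4 M
  chain-of-cyclic {A} {B} {C} {D} cA cB cC cD A⊆B B⊆C C⊆D ρA<ρB ρB<ρC ρC<ρD =
    cl M A , cl M B , cl M C , cl M D ,
    cl-cyclicFlat cA , cl-cyclicFlat cB , cl-cyclicFlat cC , cl-cyclicFlat cD ,
    cl-⊂ A⊆B ρA<ρB , cl-⊂ B⊆C ρB<ρC , cl-⊂ C⊆D ρC<ρD

  ⊥-cyclic : Cyclic ⊥
  ⊥-cyclic y∈⊥ = ⊥-elim (∉⊥ y∈⊥)

  ⊤-cyclic : (∀ x → ¬ IsIsthmus M x) → Cyclic ⊤
  ⊤-cyclic no-isthmus {y} _ = ≤-antisym (ρ-monotone (p─q⊆p ⊤ ⁅ y ⁆)) (≮⇒≥ (no-isthmus y))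

  ρ∁X<ρ⊤⇒2≤∣X∣ : (∀ x → ¬ IsIsthmus M x) → ∀ X → ρ M (∁ X) < ρ M ⊤ → 2 ≤ ∣ X ∣
  ρ∁X<ρ⊤⇒2≤∣X∣ no-isthmus X ρ∁X<ρ⊤ with 2 ≤? ∣ X ∣ | nonempty? X
  ... | yes 2≤∣X∣ | _           = 2≤∣X∣
  ... | no _      | no X-empty  =
        ⊥-elim (<⇒≱ ρ∁X<ρ⊤ (ρ-monotone λ {y} _ → x∉p⇒x∈∁p λ y∈X → X-empty (y , y∈X)))
  ... | no 2≰∣X∣  | yes (x , x∈X) =
        ⊥-elim (no-isthmus x (≤-<-trans (ρ-monotone ⊤-x⊆∁X) ρ∁X<ρ⊤))
    where
    ⊤-x⊆∁X : ⊤ - x ⊆ ∁ X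
    ⊤-x⊆∁X y∈⊤-x = x∉p⇒x∈∁p λ y∈X →
      x∈p-y⇒x≢y ⊤ y∈⊤-x (x∈⁅y⁆⇒x≡y x (∣p∣≤1⇒p⊆⁅x⁆ (≤-pred (≰⇒> 2≰∣X∣)) x∈X y∈X))

  module ParallelPair {e f : Fin n} (par : Parallel M e f) where

    e≢f : e ≢ f
    e≢f = proj₁ par

    ρ⁅e⁆≡1 : ρ M ⁅ e ⁆ ≡ 1
    ρ⁅e⁆≡1 = proj₁ (proj₂ par)

    ρ⁅f⁆≡1 : ρ M ⁅ f ⁆ ≡ 1
    ρ⁅f⁆≡1 = proj₁ (proj₂ (proj₂ par))

    ρ⁅e⁆∪⁅f⁆≡1 : ρ M (⁅ e ⁆ ∪ ⁅ f ⁆) ≡ 1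
    ρ⁅e⁆∪⁅f⁆≡1 = proj₂ (proj₂ (proj₂ par))

    e-spans-f : Spans ⁅ e ⁆ f
    e-spans-f = trans ρ⁅e⁆∪⁅f⁆≡1 (sym ρ⁅e⁆≡1)

    f-spans-e : Spans ⁅ f ⁆ e
    f-spans-e = trans (cong (ρ M) (∪-comm ⁅ f ⁆ ⁅ e ⁆)) (trans ρ⁅e⁆∪⁅f⁆≡1 (sym ρ⁅f⁆≡1))

    ρ-∪⁅f⁆ : ∀ {X} → e ∈ X → ρ M (X ∪ ⁅ f ⁆) ≡ ρ M X
    ρ-∪⁅f⁆ e∈X = spans-mono (x∈p⇒⁅x⁆⊆p e∈X) e-spans-f

    pair-cyclic : Cyclic (⁅ e ⁆ ∪ ⁅ f ⁆)
    pair-cyclic {y} y∈pair = [ remove-e , remove-f ]′ (x∈p∪q⁻ ⁅ e ⁆ ⁅ f ⁆ y∈pair)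
      where
      remove-e : y ∈ ⁅ e ⁆ → ρ M ((⁅ e ⁆ ∪ ⁅ f ⁆) - y) ≡ ρ M (⁅ e ⁆ ∪ ⁅ f ⁆)
      remove-e y∈⁅e⁆ rewrite x∈⁅y⁆⇒x≡y e y∈⁅e⁆ = ρ-minus-spanned-by (q⊆p∪q ⁅ e ⁆ ⁅ f ⁆ (x∈⁅x⁆ f)) (e≢f ∘ sym) f-spans-e
      remove-f : y ∈ ⁅ f ⁆ → ρ M ((⁅ e ⁆ ∪ ⁅ f ⁆) - y) ≡ ρ M (⁅ e ⁆ ∪ ⁅ f ⁆)
      remove-f y∈⁅f⁆ rewrite x∈⁅y⁆⇒x≡y f y∈⁅f⁆ = ρ-minus-spanned-by (p⊆p∪q ⁅ f ⁆ (x∈⁅x⁆ e)) e≢f e-spans-f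

    Outside : Fin n → Set
    Outside x = ¬ Spans ⁅ e ⁆ x

    outside? : ∀ x → Dec (Outside x)
    outside? x = ¬? (ρ M (⁅ e ⁆ ∪ ⁅ x ⁆) ≟ ρ M ⁅ e ⁆)

    outsiders : Subset n
    outsiders = tabulate (λ x → ⌊ outside? x ⌋)

    e∉outsiders : e ∉ outsiders
    e∉outsiders e∈out = ∈-tabulate⁻ outside? e∈out (spans-∈ (x∈⁅x⁆ e))

    2≤ρ⁅e⁆∪⁅x⁆ : ∀ {x} → x ∈ outsiders → 2 ≤ ρ M (⁅ e ⁆ ∪ ⁅ x ⁆)
    2≤ρ⁅e⁆∪⁅x⁆ x∈out = ≤∧≢⇒< (≤-trans (≤-reflexive (sym ρ⁅e⁆≡1)) (ρ-monotone (p⊆p∪q _)))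
      λ 1≡ρ → ∈-tabulate⁻ outside? x∈out (trans (sym 1≡ρ) (sym ρ⁅e⁆≡1))

    ρ∁≤1+∣outsiders─∣ : ∀ D → ρ M (∁ D) ≤ suc ∣ outsiders ─ D ∣
    ρ∁≤1+∣outsiders─∣ D = begin
      ρ M (∁ D)                        ≤⟨ ρ-≤-spanned spanned ⟩
      ρ M ((outsiders ─ D) ∪ ⁅ e ⁆)      ≤⟨ ρ-bounded M _ ⟩
      ∣ (outsiders ─ D) ∪ ⁅ e ⁆ ∣        ≤⟨ ∣p∪⁅x⁆∣≤1+∣p∣ (outsiders ─ D) e ⟩
      suc ∣ outsiders ─ D ∣              ∎
      where
      open ≤-Reasoning
      spanned : ∀ {x} → x ∈ ∁ D → Spans ((outsiders ─ D) ∪ ⁅ e ⁆) x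
      spanned {x} x∈∁D with outside? x
      ... | yes x-out = spans-∈ (p⊆p∪q ⁅ e ⁆ (x∈p∧x∉q⇒x∈p─q (∈-tabulate⁺ outside? x-out) (x∈∁p⇒x∉p x∈∁D)))
      ... | no ¬x-out = spans-mono (q⊆p∪q _ ⁅ e ⁆) (decidable-stable (_ ≟ _) ¬x-out)

    ρ⊤≤1+∣outsiders∣ : ρ M ⊤ ≤ suc ∣ outsiders ∣
    ρ⊤≤1+∣outsiders∣ = begin
      ρ M ⊤                  ≤⟨ ρ-monotone (λ _ → x∉p⇒x∈∁p ∉⊥) ⟩
      ρ M (∁ ⊥)              ≤⟨ ρ∁≤1+∣outsiders─∣ ⊥ ⟩
      suc ∣ outsiders ─ ⊥ ∣  ≡⟨ cong (suc ∘ ∣_∣) (p─⊥≡p outsiders) ⟩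
      suc ∣ outsiders ∣      ∎
      where open ≤-Reasoning

    cyclic-Z∪e∪f : ∀ {Z} → Z ⊆ outsiders → (∀ {y} → y ∈ Z → ρ M (Z ∪ ⁅ e ⁆) ≤ ρ M ((Z - y) ∪ ⁅ e ⁆)) →
                   Cyclic ((Z ∪ ⁅ e ⁆) ∪ ⁅ f ⁆)
    cyclic-Z∪e∪f {Z} Z⊆outs redundant {y} y∈Y =
      [ [ remove-Z , remove-e ]′ ∘ x∈p∪q⁻ Z ⁅ e ⁆ , remove-f ]′ (x∈p∪q⁻ (Z ∪ ⁅ e ⁆) ⁅ f ⁆ y∈Y)
      where
      Y : Subset n
      Y = (Z ∪ ⁅ e ⁆) ∪ ⁅ f ⁆
      e∈Y : e ∈ Y
      e∈Y = p⊆p∪q ⁅ f ⁆ (q⊆p∪q Z ⁅ e ⁆ (x∈⁅x⁆ e))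
      f∈Y : f ∈ Y
      f∈Y = q⊆p∪q (Z ∪ ⁅ e ⁆) ⁅ f ⁆ (x∈⁅x⁆ f)
      remove-f : y ∈ ⁅ f ⁆ → ρ M (Y - y) ≡ ρ M Y
      remove-f y∈⁅f⁆ rewrite x∈⁅y⁆⇒x≡y f y∈⁅f⁆ = ρ-minus-spanned-by e∈Y e≢f e-spans-f
      remove-e : y ∈ ⁅ e ⁆ → ρ M (Y - y) ≡ ρ M Y
      remove-e y∈⁅e⁆ rewrite x∈⁅y⁆⇒x≡y e y∈⁅e⁆ = ρ-minus-spanned-by f∈Y (e≢f ∘ sym) f-spans-e
      remove-Z : y ∈ Z → ρ M (Y - y) ≡ ρ M Y
      remove-Z y∈Z = ρ-minus-≡ {W = (Z - y) ∪ ⁅ e ⁆}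
        (∪-least (λ z∈Z-y → x∈p∧x≢y⇒x∈p-y (p⊆p∪q ⁅ f ⁆ (p⊆p∪q ⁅ e ⁆ (p─q⊆p Z ⁅ y ⁆ z∈Z-y))) (x∈p-y⇒x≢y Z z∈Z-y))
                 (x∈p⇒⁅x⁆⊆p (x∈p∧x≢y⇒x∈p-y e∈Y λ { refl → e∉outsiders (Z⊆outs y∈Z) })))
        (≤-trans (≤-reflexive (ρ-∪⁅f⁆ (q⊆p∪q Z ⁅ e ⁆ (x∈⁅x⁆ e)))) (redundant y∈Z))

    module Height3 (no-isthmus : ∀ x → ¬ IsIsthmus M x) (no-chain : ¬ ChainOf4 M) where

      no-cyclic-above-pair : ∀ {Y} → Cyclic Y → ⁅ e ⁆ ∪ ⁅ f ⁆ ⊆ Y → 2 ≤ ρ M Y → ¬ ρ M Y < ρ M ⊤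
      no-cyclic-above-pair {Y} Y-cyclic pair⊆Y 2≤ρY ρY<ρ⊤ =
        no-chain (chain-of-cyclic ⊥-cyclic pair-cyclic Y-cyclic (⊤-cyclic no-isthmus) ⊥⊆ pair⊆Y ⊆⊤
                    (subst₂ _<_ (sym ρ⊥≡0) (sym ρ⁅e⁆∪⁅f⁆≡1) (s≤s z≤n))
                    (subst (_< ρ M Y) (sym ρ⁅e⁆∪⁅f⁆≡1) 2≤ρY)
                    ρY<ρ⊤)

      ρ-outsiders-∪⁅e⁆ : ∀ s Z → ∣ Z ∣ ≡ s → Z ⊆ outsiders → s < ρ M ⊤ → ρ M (Z ∪ ⁅ e ⁆) ≡ suc s
      ρ-outsiders-∪⁅e⁆ zero Z ∣Z∣≡0 _ _ =
        trans (cong (λ X → ρ M (X ∪ ⁅ e ⁆)) (∣p∣≡0⇒p≡⊥ ∣Z∣≡0)) (trans (cong (ρ M) (∪-identityˡ ⁅ e ⁆)) ρ⁅e⁆≡1)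
      ρ-outsiders-∪⁅e⁆ (suc s) Z ∣Z∣≡1+s Z⊆outs 1+s<ρ⊤
        with ρ M (Z ∪ ⁅ e ⁆) ≟ suc (suc s) | 0<∣p∣⇒Nonempty (subst (0 <_) (sym ∣Z∣≡1+s) (s≤s z≤n))
      ... | yes ρZ∪e≡2+s | _        = ρZ∪e≡2+s
      ... | no ρZ∪e≢2+s  | z , z∈Z  =
        ⊥-elim (no-cyclic-above-pair (cyclic-Z∪e∪f Z⊆outs redundant) pair⊆Y 2≤ρY
                  (subst (_< ρ M ⊤) (sym (trans (ρ-∪⁅f⁆ e∈Z∪e) ρZ∪e≡1+s)) 1+s<ρ⊤))
        where
        ρ-minus∪e : ∀ {y} → y ∈ Z → ρ M ((Z - y) ∪ ⁅ e ⁆) ≡ suc s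
        ρ-minus∪e {y} y∈Z = ρ-outsiders-∪⁅e⁆ s (Z - y) (suc-injective (trans (sym (∣p∣≡1+∣p-x∣ y∈Z)) ∣Z∣≡1+s))
                                          (Z⊆outs ∘ p─q⊆p Z _) (<⇒≤ 1+s<ρ⊤)
        e∈Z∪e : e ∈ Z ∪ ⁅ e ⁆
        e∈Z∪e = q⊆p∪q Z ⁅ e ⁆ (x∈⁅x⁆ e)
        ρZ∪e≡1+s : ρ M (Z ∪ ⁅ e ⁆) ≡ suc s
        ρZ∪e≡1+s = ≤-antisym
          (≤-pred (≤∧≢⇒< (≤-trans (ρ-bounded M _) (≤-trans (∣p∪⁅x⁆∣≤1+∣p∣ Z e) (≤-reflexive (cong suc ∣Z∣≡1+s))))
                         ρZ∪e≢2+s))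
          (≤-trans (≤-reflexive (sym (ρ-minus∪e z∈Z))) (ρ-monotone (∪-least (p⊆p∪q ⁅ e ⁆ ∘ p─q⊆p Z _) (q⊆p∪q Z _))))
        redundant : ∀ {y} → y ∈ Z → ρ M (Z ∪ ⁅ e ⁆) ≤ ρ M ((Z - y) ∪ ⁅ e ⁆)
        redundant y∈Z = ≤-reflexive (trans ρZ∪e≡1+s (sym (ρ-minus∪e y∈Z)))
        Y : Subset n
        Y = (Z ∪ ⁅ e ⁆) ∪ ⁅ f ⁆
        ⁅x⁆⊆Y : ∀ {x} → x ∈ Z ∪ ⁅ e ⁆ → ⁅ x ⁆ ⊆ Y
        ⁅x⁆⊆Y x∈Z∪e = x∈p⇒⁅x⁆⊆p (p⊆p∪q ⁅ f ⁆ x∈Z∪e)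
        pair⊆Y : ⁅ e ⁆ ∪ ⁅ f ⁆ ⊆ Y
        pair⊆Y = ∪-least (⁅x⁆⊆Y e∈Z∪e) (q⊆p∪q _ ⁅ f ⁆)
        2≤ρY : 2 ≤ ρ M Y
        2≤ρY = ≤-trans (2≤ρ⁅e⁆∪⁅x⁆ (Z⊆outs z∈Z)) (ρ-monotone (∪-least (⁅x⁆⊆Y e∈Z∪e) (⁅x⁆⊆Y (p⊆p∪q ⁅ e ⁆ z∈Z))))

      outsiders-∪⁅e⁆-independent : ∀ {Z} → Z ⊆ outsiders → ∣ Z ∣ < ρ M ⊤ → ρ M (Z ∪ ⁅ e ⁆) ≡ ∣ Z ∪ ⁅ e ⁆ ∣
      outsiders-∪⁅e⁆-independent {Z} Z⊆outs ∣Z∣<ρ⊤ =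
        trans (ρ-outsiders-∪⁅e⁆ _ Z refl Z⊆outs ∣Z∣<ρ⊤) (sym (∣p∪⁅x⁆∣≡1+∣p∣ Z (e∉outsiders ∘ Z⊆outs)))

      module Binary {m} {v : Fin n → F₂^ m} (rep : ∀ X → IsF₂Rank v X (ρ M X)) where

        open F₂Representation M rep

        outsiders-∪⁅e⁆-LinIndep : ∀ {Z} → Z ⊆ outsiders → ∣ Z ∣ < ρ M ⊤ → LinIndep v (Z ∪ ⁅ e ⁆)
        outsiders-∪⁅e⁆-LinIndep Z⊆outs ∣Z∣<ρ⊤ = independent⇒LinIndep (outsiders-∪⁅e⁆-independent Z⊆outs ∣Z∣<ρ⊤)

        outsiders-sum-∉⟨e⟩ : ∀ {W} → W ⊆ outsiders → W ≢ ⊥ → ∣ W ∣ < ρ M ⊤ → ¬ sumOver v W ∈⟨ v e ⟩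
        outsiders-sum-∉⟨e⟩ {W} W⊆outs W≢⊥ ∣W∣<ρ⊤ = [ W-indep W (p⊆p∪q ⁅ e ⁆) W≢⊥ , ΣW≢ve ]′
          where
          W-indep : LinIndep v (W ∪ ⁅ e ⁆)
          W-indep = outsiders-∪⁅e⁆-LinIndep W⊆outs ∣W∣<ρ⊤
          ΣW≢ve : sumOver v W ≢ v e
          ΣW≢ve ΣW≡ve = W-indep (W ∪ ⁅ e ⁆) ⊆-refl
            (λ W∪e≡⊥ → ∉⊥ (subst (e ∈_) W∪e≡⊥ (q⊆p∪q W ⁅ e ⁆ (x∈⁅x⁆ e))))
            (trans (sumOver-∪⁅x⁆ v W (e∉outsiders ∘ W⊆outs)) (trans (cong (λ s → addV s (v e)) ΣW≡ve) (addV-self (v e))))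

        outsiders-basis-∪⁅e⁆-dependent : ∀ {C} → C ⊆ outsiders → ∣ C ∣ ≡ ρ M ⊤ → ρ M (C ∪ ⁅ e ⁆) < ∣ C ∪ ⁅ e ⁆ ∣
        outsiders-basis-∪⁅e⁆-dependent {C} C⊆outs ∣C∣≡ρ⊤ = begin-strict
          ρ M (C ∪ ⁅ e ⁆)  ≤⟨ ρ-monotone ⊆⊤ ⟩
          ρ M ⊤            ≡⟨ sym ∣C∣≡ρ⊤ ⟩
          ∣ C ∣            <⟨ n<1+n ∣ C ∣ ⟩
          suc ∣ C ∣        ≡⟨ sym (∣p∪⁅x⁆∣≡1+∣p∣ C (e∉outsiders ∘ C⊆outs)) ⟩
          ∣ C ∪ ⁅ e ⁆ ∣    ∎
          where open ≤-Reasoning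

        outsiders-basis-sum-∈⟨e⟩ : ∀ {C} → C ⊆ outsiders → ∣ C ∣ ≡ ρ M ⊤ → sumOver v C ∈⟨ v e ⟩
        outsiders-basis-sum-∈⟨e⟩ {C} C⊆outs ∣C∣≡ρ⊤
          with dependency (C ∪ ⁅ e ⁆) (outsiders-basis-∪⁅e⁆-dependent C⊆outs ∣C∣≡ρ⊤)
        ... | W , W⊆C∪e , W≢⊥ , ΣW≡0 with ∣ W - e ∣ <? ρ M ⊤
        -- W ⊆ (W - e) ∪ {e}, which is independent unless W - e is all of C.
        ...   | yes ∣W-e∣<ρ⊤ = ⊥-elim (outsiders-∪⁅e⁆-LinIndep (C⊆outs ∘ p⊆q∪⁅x⁆⇒p-x⊆q W⊆C∪e) ∣W-e∣<ρ⊤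
                                         W (p⊆p-x∪⁅x⁆ W e) W≢⊥ ΣW≡0)
        ...   | no ∣W-e∣≮ρ⊤  = subst (λ T → sumOver v T ∈⟨ v e ⟩)
                                     (p⊆q∧∣q∣≤∣p∣⇒p≡q (p⊆q∪⁅x⁆⇒p-x⊆q W⊆C∪e) (≤-trans (≤-reflexive ∣C∣≡ρ⊤) (≮⇒≥ ∣W-e∣≮ρ⊤)))
                                     (sumOver-minus-∈⟨⟩ v W e ΣW≡0)

        few-outsiders-beyond-pair : ∀ {r} → ρ M ⊤ ≡ suc r → 2 ≤ r → ∀ {a b} → a ∈ outsiders → b ∈ outsiders → a ≢ b →
                                    ∣ outsiders ─ (⁅ a ⁆ ∪ ⁅ b ⁆) ∣ < r
        few-outsiders-beyond-pair {r} ρ⊤≡1+r 2≤r {a} {b} a∈outs b∈outs a≢b with r ≤? ∣ outsiders ─ (⁅ a ⁆ ∪ ⁅ b ⁆) ∣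
        ... | no r≰ = ≰⇒> r≰
        ... | yes r≤ with subset-of-size (outsiders ─ (⁅ a ⁆ ∪ ⁅ b ⁆)) r r≤
        ...   | Z , Z⊆ , ∣Z∣≡r = ⊥-elim (outsiders-sum-∉⟨e⟩ D⊆outs D≢⊥ ∣D∣<ρ⊤ ΣD∈⟨e⟩)
          where
          D : Subset n
          D = ⁅ a ⁆ ∪ ⁅ b ⁆
          D⊆outs : D ⊆ outsiders
          D⊆outs = ∪-least (x∈p⇒⁅x⁆⊆p a∈outs) (x∈p⇒⁅x⁆⊆p b∈outs)
          a∈D : a ∈ D
          a∈D = p⊆p∪q ⁅ b ⁆ (x∈⁅x⁆ a)
          D≢⊥ : D ≢ ⊥
          D≢⊥ D≡⊥ = ∉⊥ (subst (a ∈_) D≡⊥ a∈D)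
          ∣D∣<ρ⊤ : ∣ D ∣ < ρ M ⊤
          ∣D∣<ρ⊤ = subst₂ _<_ (sym (∣⁅x⁆∪⁅y⁆∣≡2 a≢b)) (sym ρ⊤≡1+r) (s≤s 2≤r)
          ΣZ+v : ∀ {x} → x ∈ outsiders → x ∈ D → addV (sumOver v Z) (v x) ∈⟨ v e ⟩
          ΣZ+v {x} x∈outs x∈D = subst (λ s → s ∈⟨ v e ⟩) (sumOver-∪⁅x⁆ v Z x∉Z)
            (outsiders-basis-sum-∈⟨e⟩ (∪-least (p─q⊆p outsiders D ∘ Z⊆) (x∈p⇒⁅x⁆⊆p x∈outs))
                                     (trans (∣p∪⁅x⁆∣≡1+∣p∣ Z x∉Z) (trans (cong suc ∣Z∣≡r) (sym ρ⊤≡1+r))))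
            where
            x∉Z : x ∉ Z
            x∉Z x∈Z = x∈p─q⇒x∉q outsiders D (Z⊆ x∈Z) x∈D
          ΣD∈⟨e⟩ : sumOver v D ∈⟨ v e ⟩
          ΣD∈⟨e⟩ = subst (λ s → s ∈⟨ v e ⟩)
            (trans (addV-cancel-common (sumOver v Z) (v a) (v b)) (sym (sumOver-⁅x⁆∪⁅y⁆ v a≢b)))
            (addV-∈⟨⟩ (ΣZ+v a∈outs a∈D) (ΣZ+v b∈outs (q⊆p∪q ⁅ a ⁆ ⁅ b ⁆ (x∈⁅x⁆ b))))

        two-element-cocircuit : ∀ {r} → ρ M ⊤ ≡ suc r → 2 ≤ r →
                                Σ (Fin n) λ a → Σ (Fin n) λ b → a ≢ b × ρ M (∁ (⁅ a ⁆ ∪ ⁅ b ⁆)) < ρ M ⊤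
        two-element-cocircuit {r} ρ⊤≡1+r 2≤r
          with two-elements (≤-pred (≤-trans (s≤s 2≤r) (subst (_≤ suc ∣ outsiders ∣) ρ⊤≡1+r ρ⊤≤1+∣outsiders∣)))
        ... | a , b , a∈outs , b∈outs , a≢b = a , b , a≢b , (begin-strict
          ρ M (∁ (⁅ a ⁆ ∪ ⁅ b ⁆))                    ≤⟨ ρ∁≤1+∣outsiders─∣ (⁅ a ⁆ ∪ ⁅ b ⁆) ⟩
          suc ∣ outsiders ─ (⁅ a ⁆ ∪ ⁅ b ⁆) ∣         <⟨ s≤s (few-outsiders-beyond-pair ρ⊤≡1+r 2≤r a∈outs b∈outs a≢b) ⟩
          suc r                                      ≡⟨ sym ρ⊤≡1+r ⟩
          ρ M ⊤                                      ∎)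
          where open ≤-Reasoning

proposition8p4 : (n k d : ℕ) (M : Matroid n) →
    Binary M → NonDegenerate M →
    ρ M ⊤ ≡ k → IsMinDistance M d → 3 ≤ k →
    Height3 M → HasParallel M → d ≡ 2
proposition8p4 n (suc r) d M (_ , _ , rep) non-degenerate ρ⊤≡1+r ((X , ρ∁X<ρ⊤ , ∣X∣≡d) , d-minimal) (s≤s 2≤r)
               (_ , no-chain) (e , f , par) = ≤-antisym d≤2 2≤d
  where
  open Rank M
  open ParallelPair par
  no-isthmus : ∀ x → ¬ IsIsthmus M x
  no-isthmus = proj₂ ∘ non-degenerate
  open Height3 no-isthmus no-chain
  open Binary rep
  d≤2 : d ≤ 2
  d≤2 = let a , b , a≢b , ρ∁ab<ρ⊤ = two-element-cocircuit ρ⊤≡1+r 2≤r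
        in ≤-trans (d-minimal (⁅ a ⁆ ∪ ⁅ b ⁆) ρ∁ab<ρ⊤) (≤-reflexive (∣⁅x⁆∪⁅y⁆∣≡2 a≢b))
  2≤d : 2 ≤ d
  2≤d = subst (2 ≤_) ∣X∣≡d (ρ∁X<ρ⊤⇒2≤∣X∣ no-isthmus X ρ∁X<ρ⊤)
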